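{- Let $n \geqslant 1$ and $d$ be integers with $\gcd(n,d)=1$, and let $\mathbb{Z}_n=\mathbb{Z}/n\mathbb{Z}$. Define $\phi:\mathbb{Z}_n \to \mathbb{Z}_n$ by $\phi(x) \equiv 1+dx$ and $i:\mathbb{Z}_n \to \mathbb{Z}_n$ by $i(x) \equiv -x$. Then the set of all images of $0$ under finite compositions of the maps $\phi$ and $i$ (i.e., the smallest subset of $\mathbb{Z}_n$ containing $0$ and closed under $\phi$ and $i$) is all of $\mathbb{Z}_n$. -}

module Defs where

open import Data.Nat using (ℕ; NonZero)
open import Data.Fin using (Fin; toℕ; fromℕ<)
open import Data.Integer using (ℤ; +_; _+_; _*_; -_; 1ℤ; _%ℕ_)
open import Data.Integer.DivMod using (n%ℕd<d)

-- Reduction of an integer into ℤ/nℤ, represented as Fin n (canonical residues 0..n-1).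
reduce : (n : ℕ) .{{_ : NonZero n}} → ℤ → Fin n
reduce n z = fromℕ< (n%ℕd<d z n)

lift : {n : ℕ} → Fin n → ℤ
lift x = + toℕ x

φ : (n : ℕ) .{{_ : NonZero n}} → ℤ → Fin n → Fin n
φ n d x = reduce n (1ℤ + d * lift x)

ι : (n : ℕ) .{{_ : NonZero n}} → Fin n → Fin n
ι n x = reduce n (- lift x)

data Reachable (n : ℕ) .{{nz : NonZero n}} (d : ℤ) : Fin n → Set where
  base : Reachable n d (reduce n (+ 0))
  step-φ : ∀ {x} → Reachable n d x → Reachable n d (φ n d x)
  step-ι : ∀ {x} → Reachable n d x → Reachable n d (ι n x)

{-# OPTIONS --safe #-}
module Submission where

open import Defs
open import Data.Nat using (ℕ; NonZero)
open import Data.Fin using (Fin)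
open import Data.Integer using (ℤ; +_)
open import Data.Integer.GCD using (gcd)
open import Relation.Binary.PropositionalEquality using (_≡_)

open import Data.Fin using (toℕ)
open import Data.Fin.Properties using (pigeonhole; toℕ<n; toℕ-injective; toℕ-fromℕ<)
open import Data.Integer using (_+_; _*_; -_; _-_; 0ℤ; 1ℤ; ∣_∣; _%ℕ_; _/ℕ_)
open import Data.Integer.Coprimality using (Coprime; coprime-divisor)
open import Data.Integer.Divisibility.Signed
  using (_∣_; divides; ∣⇒∣ᵤ; ∣ᵤ⇒∣; ∣m⇒∣-m; ∣m∣n⇒∣m+n; ∣n⇒∣m*n)
open import Data.Integer.DivMod using (a≡a%ℕn+[a/ℕn]*n)
open import Data.Integer.Properties
  using (+-injective; +-inverseʳ; *-zeroˡ; *-zeroʳ; neg-involutive; neg-distrib-+; +-minus-telescope;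
         ∣i∣≡0⇒i≡0; i-j≡0⇒i≡j; m-n≡m⊖n; ∣m⊝n∣≤m⊔n)
open import Data.Integer.Tactic.RingSolver using (solve-∀)
import Data.Nat as ℕ
open import Data.Nat using (zero; suc)
open import Data.Nat.Coprimality using (gcd≡1⇒coprime)
import Data.Nat.Divisibility as ℕ
open import Data.Nat.Divisibility using (>⇒∤)
open import Data.Nat.GeneralisedArithmetic using (fold; fold-+)
import Data.Nat.Properties as ℕ
open import Data.Product using (∃-syntax; _×_; _,_)
open import Function.Definitions using (Injective)
open import Relation.Binary.Bundles using (Setoid)
open import Relation.Binary.PropositionalEquality
  using (refl; sym; trans; cong; cong₂; subst; module ≡-Reasoning)
import Relation.Binary.Reasoning.Setoid as SetoidReasoning
open import Relation.Nullary using (contradiction)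

-- Since gcd(n, d) = 1, φ is injective on the finite set ℤ/nℤ, hence a permutation, so φ⁻¹ is a
-- power of φ and the reachable set is closed under φ⁻¹ as well. Now if φ(w) = -z, then
-- φ(-w) = 1 - dw = 2 - (1 + dw) = z + 2: the reachable set is closed under z ↦ z + 2. It contains
-- 0 and φ(0) = 1, so it contains every residue.

fold-injective : ∀ {a} {A : Set a} {f : A → A} → Injective _≡_ _≡_ f →
                 ∀ m {x y} → fold x f m ≡ fold y f m → x ≡ y
fold-injective f-inj zero    eq = eq
fold-injective f-inj (suc m) eq = fold-injective f-inj m (f-inj eq)

injective⇒periodic : ∀ {n} {f : Fin n → Fin n} → Injective _≡_ _≡_ f →
                     ∀ x → ∃[ m ] f (fold x f m) ≡ x
injective⇒periodic {n} {f} f-inj x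
  with pigeonhole (ℕ.n<1+n n) (λ k → fold x f (toℕ k))
... | i , j , i<j , fⁱx≡fʲx with ℕ.m≤n⇒∃[o]m+o≡n i<j
...   | m , 1+i+m≡j = m , sym (fold-injective f-inj (toℕ i) (begin
        fold x f (toℕ i)                   ≡⟨ fⁱx≡fʲx ⟩
        fold x f (toℕ j)                   ≡⟨ cong (fold x f) i+[1+m]≡j ⟨
        fold x f (toℕ i ℕ.+ suc m)         ≡⟨ fold-+ x f (toℕ i) ⟩
        fold (fold x f (suc m)) f (toℕ i)  ∎))
  where
  open ≡-Reasoning
  i+[1+m]≡j : toℕ i ℕ.+ suc m ≡ toℕ j
  i+[1+m]≡j = trans (ℕ.+-suc (toℕ i) m) 1+i+m≡j

-- A record rather than a synonym for + n ∣ a - b, so that a and b can be inferred.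
infix 4 _≡_mod_
record _≡_mod_ (a b : ℤ) (n : ℕ) : Set where
  constructor congruent
  field n∣a-b : + n ∣ a - b

[a+b]-[a+c]≡b-c : ∀ a b c → (a + b) - (a + c) ≡ b - c
[a+b]-[a+c]≡b-c = solve-∀

a[b-c]≡ab-ac : ∀ a b c → a * (b - c) ≡ a * b - a * c
a[b-c]≡ab-ac = solve-∀

module _ {n : ℕ} where

  ≡-mod-refl : ∀ {a} → a ≡ a mod n
  ≡-mod-refl {a} = congruent (divides 0ℤ (trans (+-inverseʳ a) (sym (*-zeroˡ (+ n)))))

  ≡-mod-sym : ∀ {a b} → a ≡ b mod n → b ≡ a mod n
  ≡-mod-sym {a} {b} (congruent n∣a-b) =
    congruent (subst (+ n ∣_) (-[a-b]≡b-a a b) (∣m⇒∣-m n∣a-b))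
    where
    -[a-b]≡b-a : ∀ a b → - (a - b) ≡ b - a
    -[a-b]≡b-a = solve-∀

  ≡-mod-trans : ∀ {a b c} → a ≡ b mod n → b ≡ c mod n → a ≡ c mod n
  ≡-mod-trans {a} {b} {c} (congruent n∣a-b) (congruent n∣b-c) =
    congruent (subst (+ n ∣_) (+-minus-telescope a b c) (∣m∣n⇒∣m+n n∣a-b n∣b-c))

  +-congˡ-≡-mod : ∀ a {b c} → b ≡ c mod n → a + b ≡ a + c mod n
  +-congˡ-≡-mod a {b} {c} (congruent n∣b-c) =
    congruent (subst (+ n ∣_) (sym ([a+b]-[a+c]≡b-c a b c)) n∣b-c)

  +-cancelˡ-≡-mod : ∀ a {b c} → a + b ≡ a + c mod n → b ≡ c mod n
  +-cancelˡ-≡-mod a {b} {c} (congruent n∣[a+b]-[a+c]) =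
    congruent (subst (+ n ∣_) ([a+b]-[a+c]≡b-c a b c) n∣[a+b]-[a+c])

  *-congˡ-≡-mod : ∀ a {b c} → b ≡ c mod n → a * b ≡ a * c mod n
  *-congˡ-≡-mod a {b} {c} (congruent n∣b-c) =
    congruent (subst (+ n ∣_) (a[b-c]≡ab-ac a b c) (∣n⇒∣m*n a n∣b-c))

  *-cancelˡ-≡-mod : ∀ a {b c} → Coprime (+ n) a → a * b ≡ a * c mod n → b ≡ c mod n
  *-cancelˡ-≡-mod a {b} {c} n⊥a (congruent n∣ab-ac) =
    congruent (∣ᵤ⇒∣ (coprime-divisor (+ n) a (b - c) n⊥a (∣⇒∣ᵤ n∣a[b-c])))
    where
    n∣a[b-c] : + n ∣ a * (b - c)
    n∣a[b-c] = subst (+ n ∣_) (sym (a[b-c]≡ab-ac a b c)) n∣ab-ac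

  neg-cong-≡-mod : ∀ {a b} → a ≡ b mod n → - a ≡ - b mod n
  neg-cong-≡-mod {a} {b} (congruent n∣a-b) =
    congruent (subst (+ n ∣_) (neg-distrib-+ a (- b)) (∣m⇒∣-m n∣a-b))

≡-mod-setoid : ℕ → Setoid _ _
≡-mod-setoid n = record
  { Carrier       = ℤ
  ; _≈_           = _≡_mod n
  ; isEquivalence = record { refl = ≡-mod-refl ; sym = ≡-mod-sym ; trans = ≡-mod-trans }
  }

n∣m∧m<n⇒m≡0 : ∀ {m n} → n ℕ.∣ m → m ℕ.< n → m ≡ 0
n∣m∧m<n⇒m≡0 {zero}  _   _   = refl
n∣m∧m<n⇒m≡0 {suc m} n∣m m<n = contradiction n∣m (>⇒∤ m<n)

module _ {n : ℕ} .{{_ : NonZero n}} where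

  lift-reduce : ∀ z → lift (reduce n z) ≡ z mod n
  lift-reduce z = congruent (divides (- (z /ℕ n)) (begin
    lift (reduce n z) - z
      ≡⟨ cong₂ _-_ (cong +_ (toℕ-fromℕ< _)) (a≡a%ℕn+[a/ℕn]*n z n) ⟩
    + (z %ℕ n) - (+ (z %ℕ n) + (z /ℕ n) * + n)
      ≡⟨ r-[r+qm]≡-qm (+ (z %ℕ n)) (z /ℕ n) (+ n) ⟩
    - (z /ℕ n) * + n
      ∎))
    where
    open ≡-Reasoning
    r-[r+qm]≡-qm : ∀ r q m → r - (r + q * m) ≡ - q * m
    r-[r+qm]≡-qm = solve-∀

  lift-injective-≡-mod : ∀ {x y : Fin n} → lift x ≡ lift y mod n → x ≡ y
  lift-injective-≡-mod {x} {y} (congruent n∣x-y) =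
    toℕ-injective (+-injective (i-j≡0⇒i≡j _ _ (∣i∣≡0⇒i≡0 ∣x-y∣≡0)))
    where
    ∣x-y∣≤x⊔y : ∣ lift x - lift y ∣ ℕ.≤ toℕ x ℕ.⊔ toℕ y
    ∣x-y∣≤x⊔y = subst (ℕ._≤ toℕ x ℕ.⊔ toℕ y) (cong ∣_∣ (sym (m-n≡m⊖n (toℕ x) (toℕ y))))
                      (∣m⊝n∣≤m⊔n (toℕ x) (toℕ y))

    ∣x-y∣<n : ∣ lift x - lift y ∣ ℕ.< n
    ∣x-y∣<n = ℕ.≤-<-trans ∣x-y∣≤x⊔y (ℕ.⊔-pres-<m (toℕ<n x) (toℕ<n y))

    ∣x-y∣≡0 : ∣ lift x - lift y ∣ ≡ 0
    ∣x-y∣≡0 = n∣m∧m<n⇒m≡0 (∣⇒∣ᵤ n∣x-y) ∣x-y∣<n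

  lift-≡-mod⇒≡-reduce : ∀ {x : Fin n} {z} → lift x ≡ z mod n → x ≡ reduce n z
  lift-≡-mod⇒≡-reduce {z = z} x≡z =
    lift-injective-≡-mod (≡-mod-trans x≡z (≡-mod-sym (lift-reduce z)))

module _ {n : ℕ} .{{_ : NonZero n}} {d : ℤ} where

  open SetoidReasoning (≡-mod-setoid n)

  φ-injective : Coprime (+ n) d → Injective _≡_ _≡_ (φ n d)
  φ-injective n⊥d {x} {y} φx≡φy =
    lift-injective-≡-mod (*-cancelˡ-≡-mod d n⊥d (+-cancelˡ-≡-mod 1ℤ (begin
      1ℤ + d * lift x  ≈⟨ lift-reduce _ ⟨
      lift (φ n d x)   ≡⟨ cong lift φx≡φy ⟩
      lift (φ n d y)   ≈⟨ lift-reduce _ ⟩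
      1ℤ + d * lift y  ∎)))

  Reachable-fold : ∀ {x} m → Reachable n d x → Reachable n d (fold x (φ n d) m)
  Reachable-fold zero    r = r
  Reachable-fold (suc m) r = step-φ (Reachable-fold m r)

  Reachable-φ-preimage : Coprime (+ n) d → ∀ {x} → Reachable n d x →
                         ∃[ w ] Reachable n d w × φ n d w ≡ x
  Reachable-φ-preimage n⊥d {x} r =
    let m , φᵐ⁺¹x≡x = injective⇒periodic {f = φ n d} (φ-injective n⊥d) x
    in fold x (φ n d) m , Reachable-fold m r , φᵐ⁺¹x≡x

  φw≡-z⇒φ[-w]≡2+z : ∀ {w} z → φ n d w ≡ ι n (reduce n z) →
                     φ n d (ι n w) ≡ reduce n (+ 2 + z)
  φw≡-z⇒φ[-w]≡2+z {w} z φw≡-z = lift-≡-mod⇒≡-reduce (begin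
    lift (φ n d (ι n w))     ≈⟨ lift-reduce _ ⟩
    1ℤ + d * lift (ι n w)    ≈⟨ +-congˡ-≡-mod 1ℤ (*-congˡ-≡-mod d (lift-reduce _)) ⟩
    1ℤ + d * - lift w        ≡⟨ 1+a[-b]≡2-[1+ab] d (lift w) ⟩
    + 2 - (1ℤ + d * lift w)  ≈⟨ +-congˡ-≡-mod (+ 2) (neg-cong-≡-mod 1+dw≡-z) ⟩
    + 2 - - z                ≡⟨ cong (λ t → + 2 + t) (neg-involutive z) ⟩
    + 2 + z                  ∎)
    where
    1+a[-b]≡2-[1+ab] : ∀ a b → 1ℤ + a * - b ≡ + 2 - (1ℤ + a * b)
    1+a[-b]≡2-[1+ab] = solve-∀

    1+dw≡-z : 1ℤ + d * lift w ≡ - z mod n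
    1+dw≡-z = begin
      1ℤ + d * lift w          ≈⟨ lift-reduce _ ⟨
      lift (φ n d w)           ≡⟨ cong lift φw≡-z ⟩
      lift (ι n (reduce n z))  ≈⟨ lift-reduce _ ⟩
      - lift (reduce n z)      ≈⟨ neg-cong-≡-mod (lift-reduce z) ⟩
      - z                      ∎

  Reachable-+2 : Coprime (+ n) d → ∀ z →
                 Reachable n d (reduce n z) → Reachable n d (reduce n (+ 2 + z))
  Reachable-+2 n⊥d z r =
    let w , rw , φw≡-z = Reachable-φ-preimage n⊥d (step-ι r)
    in subst (Reachable n d) (φw≡-z⇒φ[-w]≡2+z z φw≡-z) (step-φ (step-ι rw))

  φ-0≡1 : φ n d (reduce n 0ℤ) ≡ reduce n 1ℤ
  φ-0≡1 = lift-≡-mod⇒≡-reduce (begin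
    lift (φ n d (reduce n 0ℤ))   ≈⟨ lift-reduce _ ⟩
    1ℤ + d * lift (reduce n 0ℤ)  ≈⟨ +-congˡ-≡-mod 1ℤ (*-congˡ-≡-mod d (lift-reduce 0ℤ)) ⟩
    1ℤ + d * 0ℤ                  ≡⟨ cong (λ t → 1ℤ + t) (*-zeroʳ d) ⟩
    1ℤ                           ∎)

  Reachable-nonNegative : Coprime (+ n) d → ∀ k → Reachable n d (reduce n (+ k))
  Reachable-nonNegative n⊥d zero          = base
  Reachable-nonNegative n⊥d (suc zero)    = subst (Reachable n d) φ-0≡1 (step-φ base)
  Reachable-nonNegative n⊥d (suc (suc k)) = Reachable-+2 n⊥d (+ k) (Reachable-nonNegative n⊥d k)

lemma1 : (n : ℕ) .{{_ : NonZero n}} (d : ℤ) → gcd (+ n) d ≡ + 1 →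
    (x : Fin n) → Reachable n d x
lemma1 n d gcd≡1 x =
  subst (Reachable n d) (sym (lift-≡-mod⇒≡-reduce ≡-mod-refl)) (Reachable-nonNegative n⊥d (toℕ x))
  where
  n⊥d : Coprime (+ n) d
  n⊥d = gcd≡1⇒coprime (+-injective gcd≡1)
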